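{- Let $p$ be an odd prime and $t\geq s\geq 1$ such that $\Sigma_{p,t,s}$ is defined. Then $\Sigma_{p,t,s}$ is symmetric, i.e., its automorphism group acts transitively on its arcs (ordered pairs of adjacent vertices).
   Context: $\mathcal{H}_{p,t,s}=\langle a,b,c\mid a^{p^t}=b^{p^s}=c^p=1,\ [a,b]=c,\ [c,a]=[c,b]=1\rangle$. For $S\subseteq H$, $\mathrm{BiCay}(H,\emptyset,\emptyset,S)$ has vertex set $H_0\cup H_1$ (two copies of $H$) and edges $\{h_0,(zh)_1\}$, $z\in S$, $h\in H$. If $t=s$ let $k=0$; if $t>s$ let $k\in\mathbb{Z}_{p^{t-s}}^*$ with $k^2-k+1\equiv0\pmod{p^{t-s}}$. Then $\Sigma_{p,t,s}=\mathrm{BiCay}(\mathcal{H}_{p,t,s},\emptyset,\emptyset,\{1,a,ba^k\})$ (independent of the admissible $k$ up to isomorphism). -}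

module Defs where

open import Level using (0ℓ)
open import Data.Nat using (ℕ; zero; suc; _+_; _*_; _∸_; _^_; _≤_; _<_; NonZero)
open import Data.Nat.Properties using (m^n≢0)
open import Data.Nat.DivMod using (_%_; m%n<n)
open import Data.Nat.Divisibility using (_∣_)
open import Data.Nat.Coprimality using (Coprime)
open import Data.Nat.Primality using (Prime; prime⇒nonZero)
open import Data.Fin using (Fin; toℕ; fromℕ<)
open import Data.Product using (Σ; _×_; _,_)
open import Data.Sum using (_⊎_; inj₁; inj₂)
open import Data.Empty using (⊥)
open import Relation.Binary.PropositionalEquality using (_≡_)
open import Function.Bundles using (_↔_; Inverse)

modF : (n : ℕ) .{{_ : NonZero n}} → ℕ → Fin n
modF n m = fromℕ< (m%n<n m n)

-- The group H_{p,t,s} = < a, b, c | a^{p^t} = b^{p^s} = c^p = 1,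
--                          [a,b] = c, [c,a] = [c,b] = 1 >
-- realised on normal forms  a^i b^j c^l  with
--   i ∈ Z_{p^t}, j ∈ Z_{p^s}, l ∈ Z_p.
-- Convention [a,b] = a⁻¹ b⁻¹ a b, so b a = a b c⁻¹ and hence
--   (a^i b^j c^l)(a^i' b^j' c^l') = a^(i+i') b^(j+j') c^(l+l'-j i').
-- (-j i' mod p is computed as (p ∸ 1) * j * i' mod p.)

module Heis (p t s : ℕ) .{{_ : NonZero p}} where

  instance
    nzt : NonZero (p ^ t)
    nzt = m^n≢0 p t
    nzs : NonZero (p ^ s)
    nzs = m^n≢0 p s

  H : Set
  H = Fin (p ^ t) × Fin (p ^ s) × Fin p

  elt : ℕ → ℕ → ℕ → H
  elt i j l = modF (p ^ t) i , modF (p ^ s) j , modF p l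

  _·_ : H → H → H
  (i , j , l) · (i' , j' , l') =
    elt (toℕ i + toℕ i') (toℕ j + toℕ j')
        (toℕ l + toℕ l' + (p ∸ 1) * (toℕ j * toℕ i'))

  one : H
  one = elt 0 0 0

  a : H
  a = elt 1 0 0

  b : H
  b = elt 0 1 0

  c : H
  c = elt 0 0 1

  pow : H → ℕ → H
  pow x zero    = one
  pow x (suc n) = x · pow x n

record Graph : Set₁ where
  field
    V   : Set
    Adj : V → V → Set

record Automorphism (G : Graph) : Set where
  open Graph G
  field
    perm    : V ↔ V
  open Inverse perm public using (to)
  field
    adj-iff : ∀ u v → (Adj u v → Adj (to u) (to v)) × (Adj (to u) (to v) → Adj u v)

ArcTransitive : Graph → Set
ArcTransitive G =
  ∀ u v u' v' → Adj u v → Adj u' v' →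
  Σ (Automorphism G) λ f → (Automorphism.to f u ≡ u') × (Automorphism.to f v ≡ v')
  where open Graph G

-- Bi-Cayley graph BiCay(H, ∅, ∅, S): vertices H₀ ∪ H₁ (inj₁ = H₀,
-- inj₂ = H₁), edges {h₀ , (z h)₁} for z ∈ S, h ∈ H.  S is a predicate.

BiCay : (H : Set) → (H → H → H) → (H → Set) → Graph
BiCay H _·_ S = record { V = H ⊎ H ; Adj = adj }
  where
  adj : H ⊎ H → H ⊎ H → Set
  adj (inj₁ h) (inj₂ g) = Σ H λ z → S z × (g ≡ z · h)
  adj (inj₂ g) (inj₁ h) = Σ H λ z → S z × (g ≡ z · h)
  adj (inj₁ _) (inj₁ _) = ⊥
  adj (inj₂ _) (inj₂ _) = ⊥

-- Admissible k: k = 0 if t = s; if t > s, k is (the representative in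
-- [0, p^(t-s)) of) a unit of Z_{p^(t-s)} with k² - k + 1 ≡ 0 (mod p^(t-s)).

Admissible : (p t s k : ℕ) → Set
Admissible p t s k =
  (t ≡ s × k ≡ 0) ⊎
  (s < t × k < p ^ (t ∸ s) × Coprime k (p ^ (t ∸ s)) × (p ^ (t ∸ s) ∣ (k * k + 1) ∸ k))

Sigma : (p t s k : ℕ) .{{_ : NonZero p}} → Graph
Sigma p t s k = BiCay H _·_ S
  where
  open Heis p t s
  S : H → Set
  S z = (z ≡ one) ⊎ (z ≡ a) ⊎ (z ≡ b · pow a k)

-- Write H_{p,t,s} as a quotient of the integer Heisenberg group G = ℤ³ in symmetric
-- coordinates, ⟨i,j,u⟩⟨i',j',u'⟩ = ⟨i+i', j+j', u+u'+ij'−ji'⟩: for odd p the map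
-- ⟨i,j,u⟩ ↦ a^i b^j c^((u−ij)/2) is a surjective homomorphism, constant on cosets of the
-- lattice p^tℤ × p^sℤ × pℤ.  In these coordinates powers are linear, so automorphisms of G
-- are linear maps, and any map of G respecting the lattice descends to H.  Three kinds of
-- automorphisms of Σ arise this way: right translations, transitive on each side; a rotation
-- fixing 1₀ and permuting 1₁ → a₁ → (ba^k)₁ cyclically, built from an automorphism α of G of
-- order 3 that respects the lattice precisely because p^(t−s) ∣ k² − k + 1; and a reflection
-- exchanging 1₀ and 1₁.  Together they carry the arc (1₀, 1₁) onto every arc.

module Submission where

open import Defs
open import Data.Nat as ℕ using (ℕ; zero; suc; z≤n; s≤s; NonZero; _^_; _≤_)
import Data.Nat.Properties as ℕ
open import Data.Nat.DivMod using (_%_; _/_; m%n<n; m≡m%n+[m/n]*n; m<n⇒m%n≡m)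
open import Data.Nat.Divisibility using (divides; m%n≡0⇒n∣m)
open import Data.Nat.Primality using (Prime; prime⇒irreducible; prime⇒nonZero)
open import Data.Integer using (ℤ; +_; -[1+_]; +[1+_]; _+_; _*_; -_; _-_; _%ℕ_; _/ℕ_)
import Data.Integer.Properties as ℤ
open import Data.Integer.DivMod using (n%ℕd<d; a≡a%ℕn+[a/ℕn]*n)
open import Data.Integer.Tactic.RingSolver using (solve)
open import Data.Fin using (Fin; toℕ; fromℕ<)
open import Data.Fin.Properties using (fromℕ<-cong; fromℕ<-toℕ; toℕ-fromℕ<; toℕ<n)
open import Data.List using (_∷_; [])
open import Data.Empty using (⊥-elim)
open import Data.Product using (Σ; _×_; _,_; proj₁; proj₂)
open import Data.Sum using (_⊎_; inj₁; inj₂; map; swap)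
open import Function using (_∘_)
open import Function.Bundles using (Inverse; mk↔ₛ′)
open import Function.Properties.Inverse using (↔-trans)
open import Relation.Binary.Bundles using (Setoid)
open import Relation.Binary.Core using (_Preserves_⟶_)
open import Relation.Binary.PropositionalEquality
import Relation.Binary.Reasoning.Setoid as SetoidReasoning

module _ {Γ : Graph} where
  open Graph Γ
  open Automorphism

  PreservesAdj : (V → V) → Set
  PreservesAdj f = ∀ {u v} → Adj u v → Adj (f u) (f v)

  automorphism : (f g : V → V) → (∀ x → f (g x) ≡ x) → (∀ x → g (f x) ≡ x) →
                 PreservesAdj f → PreservesAdj g → Automorphism Γ
  automorphism f g fg gf f-adj g-adj = record
    { perm    = mk↔ₛ′ f g fg gf
    ; adj-iff = λ u v → f-adj , λ e → subst₂ Adj (gf u) (gf v) (g-adj e)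
    }

  infixr 9 _∘ᴬ_
  _∘ᴬ_ : Automorphism Γ → Automorphism Γ → Automorphism Γ
  φ ∘ᴬ ψ = record
    { perm    = ↔-trans (perm ψ) (perm φ)
    ; adj-iff = λ u v → proj₁ (adj-iff φ _ _) ∘ proj₁ (adj-iff ψ u v)
                      , proj₂ (adj-iff ψ u v) ∘ proj₂ (adj-iff φ _ _)
    }

  _⁻¹ᴬ : Automorphism Γ → Automorphism Γ
  φ ⁻¹ᴬ = automorphism from (to φ) strictlyInverseʳ strictlyInverseˡ
                       from-adj (proj₁ (adj-iff φ _ _))
    where
    open Inverse (perm φ) using (from; strictlyInverseˡ; strictlyInverseʳ)
    from-adj : PreservesAdj from
    from-adj {u} {v} e = proj₂ (adj-iff φ (from u) (from v))
      (subst₂ Adj (sym (strictlyInverseˡ u)) (sym (strictlyInverseˡ v)) e)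

  arcTransitive-from-arc : ∀ u₀ v₀ →
    (∀ {u v} → Adj u v → Σ (Automorphism Γ) λ φ → to φ u₀ ≡ u × to φ v₀ ≡ v) →
    ArcTransitive Γ
  arcTransitive-from-arc u₀ v₀ reach u v u' v' e e' with reach e | reach e'
  ... | φ , φu₀ , φv₀ | ψ , ψu₀ , ψv₀ =
    ψ ∘ᴬ φ ⁻¹ᴬ , moves φu₀ ψu₀ , moves φv₀ ψv₀
    where
    moves : ∀ {x y y'} → to φ x ≡ y → to ψ x ≡ y' → to (ψ ∘ᴬ φ ⁻¹ᴬ) y ≡ y'
    moves {x} refl ψx = trans (cong (to ψ) (Inverse.strictlyInverseʳ (perm φ) x)) ψx

infix 4 _∈⟅_,_,_⟆
_∈⟅_,_,_⟆ : {A : Set} → A → A → A → A → Set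
x ∈⟅ a , b , c ⟆ = x ≡ a ⊎ x ≡ b ⊎ x ≡ c

module _ {A B : Set} (f : A → B) {a b c : A} {a' b' c' : B} where

  ∈⟅⟆-map : f a ∈⟅ a' , b' , c' ⟆ → f b ∈⟅ a' , b' , c' ⟆ → f c ∈⟅ a' , b' , c' ⟆ →
            ∀ {x} → x ∈⟅ a , b , c ⟆ → f x ∈⟅ a' , b' , c' ⟆
  ∈⟅⟆-map fa _  _  (inj₁ refl)        = fa
  ∈⟅⟆-map _  fb _  (inj₂ (inj₁ refl)) = fb
  ∈⟅⟆-map _  _  fc (inj₂ (inj₂ refl)) = fc

  ∈⟅⟆-preimage : f a ≡ a' → f b ≡ b' → f c ≡ c' →
                 ∀ {y} → y ∈⟅ a' , b' , c' ⟆ → Σ A λ x → x ∈⟅ a , b , c ⟆ × f x ≡ y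
  ∈⟅⟆-preimage fa _  _  (inj₁ refl)        = a , inj₁ refl , fa
  ∈⟅⟆-preimage _  fb _  (inj₂ (inj₁ refl)) = b , inj₂ (inj₁ refl) , fb
  ∈⟅⟆-preimage _  _  fc (inj₂ (inj₂ refl)) = c , inj₂ (inj₂ refl) , fc

module _ {H : Set} (_·_ : H → H → H) (S : H → Set) where

  Edge : H → H → Set
  Edge h g = Σ H λ z → S z × (g ≡ z · h)

  map-preservesAdj : ∀ {f₀ f₁} → (∀ {h g} → Edge h g → Edge (f₀ h) (f₁ g)) →
                     PreservesAdj {BiCay H _·_ S} (map f₀ f₁)
  map-preservesAdj edge {inj₁ h} {inj₂ g} e = edge e
  map-preservesAdj edge {inj₂ g} {inj₁ h} e = edge e

  swap-map-preservesAdj : ∀ {f₀ f₁} → (∀ {h g} → Edge h g → Edge (f₁ g) (f₀ h)) →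
                          PreservesAdj {BiCay H _·_ S} (swap ∘ map f₀ f₁)
  swap-map-preservesAdj edge {inj₁ h} {inj₂ g} e = edge e
  swap-map-preservesAdj edge {inj₂ g} {inj₁ h} e = edge e

  translation : (∀ x y z → (x · y) · z ≡ x · (y · z)) →
                ∀ w w' → (∀ x → (x · w) · w' ≡ x) → (∀ x → (x · w') · w ≡ x) →
                Automorphism (BiCay H _·_ S)
  translation assoc w w' ww' w'w = automorphism
    (map (_· w) (_· w)) (map (_· w') (_· w'))
    (λ { (inj₁ x) → cong inj₁ (w'w x) ; (inj₂ x) → cong inj₂ (w'w x) })
    (λ { (inj₁ x) → cong inj₁ (ww' x) ; (inj₂ x) → cong inj₂ (ww' x) })
    (map-preservesAdj (translate-edge w)) (map-preservesAdj (translate-edge w'))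
    where
    translate-edge : ∀ v {h g} → Edge h g → Edge (h · v) (g · v)
    translate-edge v {h} (z , z∈S , refl) = z , z∈S , assoc z h v

infix 4 _≡_⟨mod_⟩
infixr 4 _,_
record _≡_⟨mod_⟩ (x y n : ℤ) : Set where
  constructor _,_
  field
    quotient : ℤ
    equation : x ≡ y + quotient * n

module _ {n : ℤ} where

  ≡-mod-reflexive : ∀ {x y} → x ≡ y → x ≡ y ⟨mod n ⟩
  ≡-mod-reflexive {x} refl = + 0 , solve (x ∷ n ∷ [])

  ≡-mod-refl : ∀ x → x ≡ x ⟨mod n ⟩
  ≡-mod-refl x = ≡-mod-reflexive refl

  ≡-mod-sym : ∀ {x y} → x ≡ y ⟨mod n ⟩ → y ≡ x ⟨mod n ⟩
  ≡-mod-sym {x} {y} (c , eq) = - c , (begin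
    y                    ≡⟨ solve (y ∷ c ∷ n ∷ []) ⟩
    y + c * n + - c * n  ≡⟨ cong (_+ - c * n) eq ⟨
    x + - c * n          ∎)
    where open ≡-Reasoning

  ≡-mod-trans : ∀ {x y z} → x ≡ y ⟨mod n ⟩ → y ≡ z ⟨mod n ⟩ → x ≡ z ⟨mod n ⟩
  ≡-mod-trans {z = z} (c , refl) (d , refl) = d + c , solve (z ∷ c ∷ d ∷ n ∷ [])

  +-cong-mod : ∀ {x x' y y'} → x ≡ x' ⟨mod n ⟩ → y ≡ y' ⟨mod n ⟩ →
               x + y ≡ x' + y' ⟨mod n ⟩
  +-cong-mod {x' = x'} {y' = y'} (c , refl) (d , refl) =
    c + d , solve (x' ∷ y' ∷ c ∷ d ∷ n ∷ [])

  *-cong-mod : ∀ {x x' y y'} → x ≡ x' ⟨mod n ⟩ → y ≡ y' ⟨mod n ⟩ →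
               x * y ≡ x' * y' ⟨mod n ⟩
  *-cong-mod {x' = x'} {y' = y'} (c , refl) (d , refl) =
    c * y' + x' * d + c * d * n , solve (x' ∷ y' ∷ c ∷ d ∷ n ∷ [])

  -‿cong-mod : ∀ {x x'} → x ≡ x' ⟨mod n ⟩ → - x ≡ - x' ⟨mod n ⟩
  -‿cong-mod {x' = x'} (c , refl) = - c , solve (x' ∷ c ∷ n ∷ [])

≡-mod-setoid : ℤ → Setoid _ _
≡-mod-setoid n = record
  { Carrier = ℤ
  ; _≈_ = _≡_⟨mod n ⟩
  ; isEquivalence = record { refl = ≡-mod-refl _ ; sym = ≡-mod-sym ; trans = ≡-mod-trans }
  }

≡-mod-modulus : ∀ {x y m n} → m ≡ n → x ≡ y ⟨mod m ⟩ → x ≡ y ⟨mod n ⟩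
≡-mod-modulus refl x≡y = x≡y

≡-mod-*ʳ : ∀ {x y} m n → x ≡ y ⟨mod m * n ⟩ → x ≡ y ⟨mod m ⟩
≡-mod-*ʳ {y = y} m n (c , refl) = c * n , solve (y ∷ c ∷ m ∷ n ∷ [])

shifted-bound : ∀ {r r'} m n → + r ≡ + r' + + suc m * + n → n ≤ r
shifted-bound {r} {r'} m n eq = begin
  n                   ≤⟨ ℕ.m≤m+n n (m ℕ.* n) ⟩
  suc m ℕ.* n         ≤⟨ ℕ.m≤n+m _ r' ⟩
  r' ℕ.+ suc m ℕ.* n  ≡⟨ ℤ.+-injective r'+[1+m]n≡r ⟩
  r                   ∎
  where
  open ℕ.≤-Reasoning
  r'+[1+m]n≡r : + (r' ℕ.+ suc m ℕ.* n) ≡ + r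
  r'+[1+m]n≡r = trans (ℤ.pos-+ r' _) (trans (cong (_+_ (+ r')) (ℤ.pos-* (suc m) n)) (sym eq))

remainder-unique : ∀ {n r r'} → r ℕ.< n → r' ℕ.< n → + r ≡ + r' ⟨mod + n ⟩ → r ≡ r'
remainder-unique {r' = r'} _ _ (+ 0 , eq) = ℤ.+-injective (trans eq (ℤ.+-identityʳ (+ r')))
remainder-unique {n} r<n _ (+[1+ m ] , eq) = ⊥-elim (ℕ.<⇒≱ r<n (shifted-bound m n eq))
remainder-unique {n} _ r'<n r≡r'@(-[1+ m ] , _) =
  ⊥-elim (ℕ.<⇒≱ r'<n (shifted-bound m n (_≡_⟨mod_⟩.equation (≡-mod-sym r≡r'))))

module _ (n : ℕ) .{{_ : NonZero n}} where

  reduce : ℤ → Fin n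
  reduce z = fromℕ< (n%ℕd<d z n)

  ≡-mod-remainder : ∀ z → z ≡ + (z %ℕ n) ⟨mod + n ⟩
  ≡-mod-remainder z = z /ℕ n , a≡a%ℕn+[a/ℕn]*n z n

  reduce-cong : ∀ {x y} → x ≡ y ⟨mod + n ⟩ → reduce x ≡ reduce y
  reduce-cong {x} {y} x≡y = fromℕ<-cong _ _ (remainder-unique (n%ℕd<d x n) (n%ℕd<d y n)
    (≡-mod-trans (≡-mod-sym (≡-mod-remainder x)) (≡-mod-trans x≡y (≡-mod-remainder y)))) _ _

  toℕ-reduce : ∀ z → + toℕ (reduce z) ≡ z ⟨mod + n ⟩
  toℕ-reduce z =
    ≡-mod-trans (≡-mod-reflexive (cong +_ (toℕ-fromℕ< _))) (≡-mod-sym (≡-mod-remainder z))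

  reduce-toℕ : ∀ i → reduce (+ toℕ i) ≡ i
  reduce-toℕ i =
    trans (fromℕ<-cong _ _ (m<n⇒m%n≡m (toℕ<n i)) _ (toℕ<n i)) (fromℕ<-toℕ i (toℕ<n i))

  toℕ-reduce-+ : ∀ x y → + (toℕ (reduce x) ℕ.+ toℕ (reduce y)) ≡ x + y ⟨mod + n ⟩
  toℕ-reduce-+ x y = ≡-mod-trans (≡-mod-reflexive (ℤ.pos-+ (toℕ (reduce x)) (toℕ (reduce y))))
                                 (+-cong-mod (toℕ-reduce x) (toℕ-reduce y))

pred≡-1 : ∀ n .{{_ : NonZero n}} → + (n ℕ.∸ 1) ≡ - + 1 ⟨mod + n ⟩
pred≡-1 (suc n) = + 1 , cong +_ (sym (ℕ.+-identityʳ n))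

-- The integer Heisenberg group in symmetric coordinates

data G : Set where
  ⟨_,_,_⟩ : ℤ → ℤ → ℤ → G

infixl 7 _⊛_
_⊛_ : G → G → G
⟨ i , j , u ⟩ ⊛ ⟨ i' , j' , u' ⟩ = ⟨ i + i' , j + j' , u + u' + (i * j' - j * i') ⟩

infix 8 _⁻¹
_⁻¹ : G → G
⟨ i , j , u ⟩ ⁻¹ = ⟨ - i , - j , - u ⟩

ε â b̂ : G
ε = ⟨ + 0 , + 0 , + 0 ⟩
â = ⟨ + 1 , + 0 , + 0 ⟩
b̂ = ⟨ + 0 , + 1 , + 0 ⟩

â^ : ℤ → G
â^ m = ⟨ m , + 0 , + 0 ⟩

G-elim : {P : G → Set} → (∀ i j u → P ⟨ i , j , u ⟩) → ∀ x → P x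
G-elim p ⟨ i , j , u ⟩ = p i j u

G-elim₂ : {P : G → G → Set} → (∀ i j u i' j' u' → P ⟨ i , j , u ⟩ ⟨ i' , j' , u' ⟩) →
          ∀ x y → P x y
G-elim₂ p ⟨ i , j , u ⟩ ⟨ i' , j' , u' ⟩ = p i j u i' j' u'

⟨⟩-cong : ∀ {i i' j j' u u'} → i ≡ i' → j ≡ j' → u ≡ u' →
          ⟨ i , j , u ⟩ ≡ ⟨ i' , j' , u' ⟩
⟨⟩-cong refl refl refl = refl

⊛-assoc : ∀ x y z → x ⊛ y ⊛ z ≡ x ⊛ (y ⊛ z)
⊛-assoc ⟨ i , j , u ⟩ ⟨ i' , j' , u' ⟩ ⟨ i'' , j'' , u'' ⟩ = ⟨⟩-cong
  (solve (i ∷ i' ∷ i'' ∷ []))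
  (solve (j ∷ j' ∷ j'' ∷ []))
  (solve (i ∷ j ∷ u ∷ i' ∷ j' ∷ u' ∷ i'' ∷ j'' ∷ u'' ∷ []))

⊛-identityˡ : ∀ x → ε ⊛ x ≡ x
⊛-identityˡ = G-elim λ i j u →
  ⟨⟩-cong (solve (i ∷ [])) (solve (j ∷ [])) (solve (i ∷ j ∷ u ∷ []))

⊛⁻¹-cancelʳ : ∀ x y → x ⊛ y ⊛ y ⁻¹ ≡ x
⊛⁻¹-cancelʳ = G-elim₂ λ i j u i' j' u' → ⟨⟩-cong
  (solve (i ∷ i' ∷ [])) (solve (j ∷ j' ∷ [])) (solve (i ∷ j ∷ u ∷ i' ∷ j' ∷ u' ∷ []))

⁻¹⊛-cancelʳ : ∀ x y → x ⊛ y ⁻¹ ⊛ y ≡ x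
⁻¹⊛-cancelʳ = G-elim₂ λ i j u i' j' u' → ⟨⟩-cong
  (solve (i ∷ i' ∷ [])) (solve (j ∷ j' ∷ [])) (solve (i ∷ j ∷ u ∷ i' ∷ j' ∷ u' ∷ []))

module _ (k : ℤ) where

  b̂â^k : G
  b̂â^k = b̂ ⊛ â^ k

  Ŝ : G → Set
  Ŝ z = z ∈⟅ ε , â , b̂â^k ⟆

  -- The automorphism with α a = a⁻¹ b a^k and α (b a^k) = a⁻¹, so that rotate permutes
  -- ε, â, b̂â^k cyclically; its linear part on (i, j) has characteristic polynomial
  -- x² + x + 1, which is why α³ is the identity.
  α : G → G
  α ⟨ i , j , u ⟩ =
    ⟨ (k - + 1) * i - (k * k - k + + 1) * j , i - k * j , u - (k + + 1) * i + (k * k + + 2 * k) * j ⟩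

  rotate : G → G
  rotate x = â ⊛ α x

  α-ε : α ε ≡ ε
  α-ε = ⟨⟩-cong (solve (k ∷ [])) (solve (k ∷ [])) (solve (k ∷ []))

  rotate-ε : rotate ε ≡ â
  rotate-ε = ⟨⟩-cong (solve (k ∷ [])) (solve (k ∷ [])) (solve (k ∷ []))

  rotate-â : rotate â ≡ b̂â^k
  rotate-â = ⟨⟩-cong (solve (k ∷ [])) (solve (k ∷ [])) (solve (k ∷ []))

  rotate-b̂â^k : rotate b̂â^k ≡ ε
  rotate-b̂â^k = ⟨⟩-cong (solve (k ∷ [])) (solve (k ∷ [])) (solve (k ∷ []))

  rotate-⊛ : ∀ z x → rotate (z ⊛ x) ≡ rotate z ⊛ α x
  rotate-⊛ = G-elim₂ λ i j u i' j' u' → ⟨⟩-cong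
    (solve (k ∷ i ∷ j ∷ i' ∷ j' ∷ []))
    (solve (k ∷ i ∷ j ∷ i' ∷ j' ∷ []))
    (solve (k ∷ i ∷ j ∷ u ∷ i' ∷ j' ∷ u' ∷ []))

  α³ : ∀ x → α (α (α x)) ≡ x
  α³ = G-elim λ i j u → ⟨⟩-cong
    (solve (k ∷ i ∷ j ∷ [])) (solve (k ∷ i ∷ j ∷ [])) (solve (k ∷ i ∷ j ∷ u ∷ []))

  rotate³ : ∀ x → rotate (rotate (rotate x)) ≡ x
  rotate³ = G-elim λ i j u → ⟨⟩-cong
    (solve (k ∷ i ∷ j ∷ [])) (solve (k ∷ i ∷ j ∷ [])) (solve (k ∷ i ∷ j ∷ u ∷ []))

  rotate-edge : ∀ {x y} → Edge _⊛_ Ŝ x y → Edge _⊛_ Ŝ (α x) (rotate y)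
  rotate-edge {x} (z , z∈Ŝ , refl) =
    rotate z
    , ∈⟅⟆-map rotate (inj₂ (inj₁ rotate-ε)) (inj₂ (inj₂ rotate-â)) (inj₁ rotate-b̂â^k) z∈Ŝ
    , rotate-⊛ z x

  β : G → G
  β ⟨ i , j , u ⟩ = ⟨ - i , - j , u + + 2 * k * j ⟩

  β-ε : β ε ≡ ε
  β-ε = ⟨⟩-cong refl refl (solve (k ∷ []))

  β-involutive : ∀ x → β (β x) ≡ x
  β-involutive = G-elim λ i j u →
    ⟨⟩-cong (solve (i ∷ [])) (solve (j ∷ [])) (solve (k ∷ j ∷ u ∷ []))

  β-twisted : ∀ {z} → Ŝ z → ∀ x → β x ≡ z ⊛ β (z ⊛ x)
  β-twisted (inj₁ refl) = G-elim λ i j u → ⟨⟩-cong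
    (solve (i ∷ [])) (solve (j ∷ [])) (solve (k ∷ i ∷ j ∷ u ∷ []))
  β-twisted (inj₂ (inj₁ refl)) = G-elim λ i j u → ⟨⟩-cong
    (solve (i ∷ [])) (solve (j ∷ [])) (solve (k ∷ i ∷ j ∷ u ∷ []))
  β-twisted (inj₂ (inj₂ refl)) = G-elim λ i j u → ⟨⟩-cong
    (solve (k ∷ i ∷ [])) (solve (j ∷ [])) (solve (k ∷ i ∷ j ∷ u ∷ []))

  reflect-edge : ∀ {x y} → Edge _⊛_ Ŝ x y → Edge _⊛_ Ŝ (β y) (β x)
  reflect-edge {x} (z , z∈Ŝ , refl) = z , z∈Ŝ , β-twisted z∈Ŝ x

-- The lattice congruence on G

infixl 6 _⊞_
_⊞_ : G → G → G
⟨ i , j , u ⟩ ⊞ ⟨ i' , j' , u' ⟩ = ⟨ i + i' , j + j' , u + u' ⟩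

module Congruence (p q e : ℤ) where

  infix 4 _≈_
  _≈_ : G → G → Set
  ⟨ i , j , u ⟩ ≈ ⟨ i' , j' , u' ⟩ =
    i ≡ i' ⟨mod p * q * e ⟩ × j ≡ j' ⟨mod p * q ⟩ × u ≡ u' ⟨mod p ⟩

  lattice : ℤ → ℤ → ℤ → G
  lattice a b c = ⟨ a * (p * q * e) , b * (p * q) , c * p ⟩

  ⊞-lattice-≈ : ∀ y a b c → y ⊞ lattice a b c ≈ y
  ⊞-lattice-≈ = G-elim λ _ _ _ a b c → (a , refl) , (b , refl) , (c , refl)

  PreservesLatticeCosets : (G → G) → Set
  PreservesLatticeCosets A = ∀ y a b c →
    Σ ℤ λ a' → Σ ℤ λ b' → Σ ℤ λ c' → A (y ⊞ lattice a b c) ≡ A y ⊞ lattice a' b' c'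

  preserves-≈ : ∀ {A} → PreservesLatticeCosets A → A Preserves _≈_ ⟶ _≈_
  preserves-≈ {A} shift {⟨ _ , _ , _ ⟩} {y@(⟨ _ , _ , _ ⟩)} ((a , refl) , (b , refl) , (c , refl))
    with shift y a b c
  ... | a' , b' , c' , eq = subst (_≈ A y) (sym eq) (⊞-lattice-≈ (A y) a' b' c')

  ⊛-shift : ∀ w → PreservesLatticeCosets (w ⊛_)
  ⊛-shift = G-elim λ i j u → G-elim λ i' j' u' a b c →
    a , b , c + i * b * q - j * a * q * e , ⟨⟩-cong
      (solve (i ∷ i' ∷ a ∷ p ∷ q ∷ e ∷ []))
      (solve (j ∷ j' ∷ b ∷ p ∷ q ∷ []))
      (solve (i ∷ j ∷ u ∷ i' ∷ j' ∷ u' ∷ a ∷ b ∷ c ∷ p ∷ q ∷ e ∷ []))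

  β-shift : ∀ k → PreservesLatticeCosets (β k)
  β-shift k = G-elim λ i j u a b c →
    - a , - b , c + + 2 * k * b * q , ⟨⟩-cong
      (solve (i ∷ a ∷ p ∷ q ∷ e ∷ []))
      (solve (j ∷ b ∷ p ∷ q ∷ []))
      (solve (k ∷ j ∷ u ∷ b ∷ c ∷ p ∷ q ∷ []))

  α-shift : ∀ k r → e * r ≡ k * k - k + + 1 → PreservesLatticeCosets (α k)
  α-shift k r er≡ = G-elim λ i j u a b c →
    (k - + 1) * a - r * b , a * e - k * b , c - (k + + 1) * a * q * e + (k * k + + 2 * k) * b * q ,
    ⟨⟩-cong
      -- Here e r = k² − k + 1 is what keeps the first coordinate in p q e ℤ.
      (subst (λ N → (k - + 1) * (i + a * (p * q * e)) - N * (j + b * (p * q))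
                    ≡ (k - + 1) * i - N * j + ((k - + 1) * a - r * b) * (p * q * e))
             er≡ (solve (k ∷ r ∷ i ∷ j ∷ a ∷ b ∷ p ∷ q ∷ e ∷ [])))
      (solve (k ∷ i ∷ j ∷ a ∷ b ∷ p ∷ q ∷ e ∷ []))
      (solve (k ∷ i ∷ j ∷ u ∷ a ∷ b ∷ c ∷ p ∷ q ∷ e ∷ []))

  ⊛-congˡ : ∀ w → (w ⊛_) Preserves _≈_ ⟶ _≈_
  ⊛-congˡ w = preserves-≈ (⊛-shift w)

-- H_{p,t,s} as a quotient of G

module Quotient (p t s : ℕ) .{{_ : NonZero p}} (q e : ℕ) (h : ℤ)
  (p^s≡ : p ^ s ≡ p ℕ.* q) (p^t≡ : p ^ t ≡ p ℕ.* q ℕ.* e)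
  (2h≡1 : + 2 * h ≡ + 1 ⟨mod + p ⟩) where

  open Heis p t s
  open Congruence (+ p) (+ q) (+ e)
  module ≡-mod-p-Reasoning = SetoidReasoning (≡-mod-setoid (+ p))

  +p^t≡ : + (p ^ t) ≡ + p * + q * + e
  +p^t≡ = trans (cong +_ p^t≡) (trans (ℤ.pos-* (p ℕ.* q) e) (cong (_* + e) (ℤ.pos-* p q)))

  +p^s≡ : + (p ^ s) ≡ + p * + q
  +p^s≡ = trans (cong +_ p^s≡) (ℤ.pos-* p q)

  mod-pqe⇒p : ∀ {x y} → x ≡ y ⟨mod + p * + q * + e ⟩ → x ≡ y ⟨mod + p ⟩
  mod-pqe⇒p = ≡-mod-*ʳ (+ p) (+ q) ∘ ≡-mod-*ʳ (+ p * + q) (+ e)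

  -- ⟨ i , j , u ⟩ ↦ a^i b^j c^((u − i j) / 2), where h inverts 2 modulo p.
  Ψ : G → H
  Ψ ⟨ i , j , u ⟩ = reduce (p ^ t) i , reduce (p ^ s) j , reduce p (h * (u - i * j))

  lift : H → G
  lift (i , j , l) = ⟨ + toℕ i , + toℕ j , + 2 * + toℕ l + + toℕ i * + toℕ j ⟩

  mod-pq⇒p : ∀ {x y} → x ≡ y ⟨mod + p * + q ⟩ → x ≡ y ⟨mod + p ⟩
  mod-pq⇒p = ≡-mod-*ʳ (+ p) (+ q)

  toℕ-reduce-p^t : ∀ i → + toℕ (reduce (p ^ t) i) ≡ i ⟨mod + p * + q * + e ⟩
  toℕ-reduce-p^t i = ≡-mod-modulus +p^t≡ (toℕ-reduce (p ^ t) i)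

  toℕ-reduce-p^s : ∀ j → + toℕ (reduce (p ^ s) j) ≡ j ⟨mod + p * + q ⟩
  toℕ-reduce-p^s j = ≡-mod-modulus +p^s≡ (toℕ-reduce (p ^ s) j)

  Ψ-cong : ∀ {x y} → x ≈ y → Ψ x ≡ Ψ y
  Ψ-cong {⟨ _ , _ , _ ⟩} {⟨ _ , _ , _ ⟩} (i≡ , j≡ , u≡) =
    cong₂ _,_ (reduce-cong (p ^ t) (≡-mod-modulus (sym +p^t≡) i≡))
   (cong₂ _,_ (reduce-cong (p ^ s) (≡-mod-modulus (sym +p^s≡) j≡))
              (reduce-cong p (*-cong-mod (≡-mod-refl h)
                (+-cong-mod u≡ (-‿cong-mod (*-cong-mod (mod-pqe⇒p i≡) (mod-pq⇒p j≡)))))))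

  Ψ-lift : ∀ x → Ψ (lift x) ≡ x
  Ψ-lift (i , j , l) = cong₂ _,_ (reduce-toℕ _ i) (cong₂ _,_ (reduce-toℕ _ j)
    (trans (reduce-cong p (halve-double (+ toℕ l) (+ toℕ i * + toℕ j))) (reduce-toℕ p l)))
    where
    open ≡-mod-p-Reasoning
    halve-double : ∀ T X → h * ((+ 2 * T + X) - X) ≡ T ⟨mod + p ⟩
    halve-double T X = begin
      h * ((+ 2 * T + X) - X)  ≡⟨ solve (h ∷ T ∷ X ∷ []) ⟩
      (+ 2 * h) * T            ≈⟨ *-cong-mod 2h≡1 (≡-mod-refl T) ⟩
      + 1 * T                  ≡⟨ solve (T ∷ []) ⟩
      T                        ∎

  lift-Ψ : ∀ x → lift (Ψ x) ≈ x
  lift-Ψ = G-elim λ i j u → toℕ-reduce-p^t i , toℕ-reduce-p^s j , (begin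
    + 2 * + toℕ (reduce p (h * (u - i * j))) + + toℕ (reduce (p ^ t) i) * + toℕ (reduce (p ^ s) j)
      ≈⟨ +-cong-mod (*-cong-mod (≡-mod-refl (+ 2)) (toℕ-reduce p (h * (u - i * j))))
                    (*-cong-mod (mod-pqe⇒p (toℕ-reduce-p^t i)) (mod-pq⇒p (toℕ-reduce-p^s j))) ⟩
    + 2 * (h * (u - i * j)) + i * j   ≡⟨ solve (h ∷ i ∷ j ∷ u ∷ []) ⟩
    (+ 2 * h) * (u - i * j) + i * j
      ≈⟨ +-cong-mod (*-cong-mod 2h≡1 (≡-mod-refl (u - i * j))) (≡-mod-refl (i * j)) ⟩
    + 1 * (u - i * j) + i * j         ≡⟨ solve (i ∷ j ∷ u ∷ []) ⟩
    u                                 ∎)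
    where open ≡-mod-p-Reasoning

  Ψ-hom : ∀ x y → Ψ x · Ψ y ≡ Ψ (x ⊛ y)
  Ψ-hom = G-elim₂ λ i j u i' j' u' →
    cong₂ _,_ (reduce-cong (p ^ t) (toℕ-reduce-+ (p ^ t) i i'))
   (cong₂ _,_ (reduce-cong (p ^ s) (toℕ-reduce-+ (p ^ s) j j'))
              (reduce-cong p (central-product i j u i' j' u'
                (toℕ-reduce p (h * (u - i * j))) (toℕ-reduce p (h * (u' - i' * j')))
                (mod-pq⇒p (toℕ-reduce-p^s j)) (mod-pqe⇒p (toℕ-reduce-p^t i')))))
    where
    open ≡-mod-p-Reasoning
    central-product : ∀ {T T' J I'} i j u i' j' u' →
      + T ≡ h * (u - i * j) ⟨mod + p ⟩ → + T' ≡ h * (u' - i' * j') ⟨mod + p ⟩ →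
      + J ≡ j ⟨mod + p ⟩ → + I' ≡ i' ⟨mod + p ⟩ →
      + (T ℕ.+ T' ℕ.+ (p ℕ.∸ 1) ℕ.* (J ℕ.* I'))
        ≡ h * ((u + u' + (i * j' - j * i')) - (i + i') * (j + j')) ⟨mod + p ⟩
    central-product {T} {T'} {J} {I'} i j u i' j' u' T≡ T'≡ J≡ I'≡ = begin
      + (T ℕ.+ T' ℕ.+ (p ℕ.∸ 1) ℕ.* (J ℕ.* I'))
        ≡⟨ trans (ℤ.pos-+ (T ℕ.+ T') _) (cong₂ _+_ (ℤ.pos-+ T T')
                 (trans (ℤ.pos-* (p ℕ.∸ 1) _) (cong (+ (p ℕ.∸ 1) *_) (ℤ.pos-* J I')))) ⟩
      + T + + T' + + (p ℕ.∸ 1) * (+ J * + I')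
        ≈⟨ +-cong-mod (+-cong-mod T≡ T'≡) (*-cong-mod (pred≡-1 p) (*-cong-mod J≡ I'≡)) ⟩
      h * (u - i * j) + h * (u' - i' * j') + - + 1 * (j * i')
        ≈⟨ +-cong-mod (≡-mod-refl (h * (u - i * j) + h * (u' - i' * j')))
                      (*-cong-mod (-‿cong-mod (≡-mod-sym 2h≡1)) (≡-mod-refl (j * i'))) ⟩
      h * (u - i * j) + h * (u' - i' * j') + - (+ 2 * h) * (j * i')
        ≡⟨ solve (h ∷ i ∷ j ∷ u ∷ i' ∷ j' ∷ u' ∷ []) ⟩
      h * ((u + u' + (i * j' - j * i')) - (i + i') * (j + j')) ∎

  ·-lift : ∀ x y → x · y ≡ Ψ (lift x ⊛ lift y)
  ·-lift x y = trans (cong₂ _·_ (sym (Ψ-lift x)) (sym (Ψ-lift y))) (Ψ-hom (lift x) (lift y))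

  ·-assoc : ∀ x y z → (x · y) · z ≡ x · (y · z)
  ·-assoc x y z = begin
    (x · y) · z                              ≡⟨ cong₂ _·_ (·-lift x y) (sym (Ψ-lift z)) ⟩
    Ψ (lift x ⊛ lift y) · Ψ (lift z)         ≡⟨ Ψ-hom (lift x ⊛ lift y) (lift z) ⟩
    Ψ (lift x ⊛ lift y ⊛ lift z)             ≡⟨ cong Ψ (⊛-assoc (lift x) (lift y) (lift z)) ⟩
    Ψ (lift x ⊛ (lift y ⊛ lift z))           ≡⟨ Ψ-hom (lift x) (lift y ⊛ lift z) ⟨
    Ψ (lift x) · Ψ (lift y ⊛ lift z)         ≡⟨ cong₂ _·_ (Ψ-lift x) (sym (·-lift y z)) ⟩
    x · (y · z)                              ∎
    where open ≡-Reasoning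

  infix 25 _⁻¹ᴴ
  _⁻¹ᴴ : H → H
  w ⁻¹ᴴ = Ψ (lift w ⁻¹)

  ·⁻¹-cancelʳ : ∀ w x → (x · w) · w ⁻¹ᴴ ≡ x
  ·⁻¹-cancelʳ w x = begin
    (x · w) · w ⁻¹ᴴ                     ≡⟨ cong (_· w ⁻¹ᴴ) (·-lift x w) ⟩
    Ψ (lift x ⊛ lift w) · w ⁻¹ᴴ          ≡⟨ Ψ-hom (lift x ⊛ lift w) (lift w ⁻¹) ⟩
    Ψ (lift x ⊛ lift w ⊛ lift w ⁻¹)      ≡⟨ cong Ψ (⊛⁻¹-cancelʳ (lift x) (lift w)) ⟩
    Ψ (lift x)                           ≡⟨ Ψ-lift x ⟩
    x                                    ∎
    where open ≡-Reasoning

  ⁻¹·-cancelʳ : ∀ w x → (x · w ⁻¹ᴴ) · w ≡ x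
  ⁻¹·-cancelʳ w x = begin
    (x · w ⁻¹ᴴ) · w
      ≡⟨ cong₂ _·_ (cong (_· w ⁻¹ᴴ) (sym (Ψ-lift x))) (sym (Ψ-lift w)) ⟩
    (Ψ (lift x) · w ⁻¹ᴴ) · Ψ (lift w)
      ≡⟨ cong (_· Ψ (lift w)) (Ψ-hom (lift x) (lift w ⁻¹)) ⟩
    Ψ (lift x ⊛ lift w ⁻¹) · Ψ (lift w)  ≡⟨ Ψ-hom (lift x ⊛ lift w ⁻¹) (lift w) ⟩
    Ψ (lift x ⊛ lift w ⁻¹ ⊛ lift w)      ≡⟨ cong Ψ (⁻¹⊛-cancelʳ (lift x) (lift w)) ⟩
    Ψ (lift x)                           ≡⟨ Ψ-lift x ⟩
    x                                    ∎
    where open ≡-Reasoning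

  one≡Ψε : one ≡ Ψ ε
  one≡Ψε = cong₂ _,_ refl (cong₂ _,_ refl (cong (reduce p) (sym (ℤ.*-zeroʳ h))))

  a≡Ψâ : a ≡ Ψ â
  a≡Ψâ = cong₂ _,_ refl (cong₂ _,_ refl (cong (reduce p) (sym (ℤ.*-zeroʳ h))))

  b≡Ψb̂ : b ≡ Ψ b̂
  b≡Ψb̂ = cong₂ _,_ refl (cong₂ _,_ refl (cong (reduce p) (sym (ℤ.*-zeroʳ h))))

  one· : ∀ x → one · x ≡ x
  one· x = begin
    one · x                   ≡⟨ cong₂ _·_ one≡Ψε (sym (Ψ-lift x)) ⟩
    Ψ ε · Ψ (lift x)          ≡⟨ Ψ-hom ε (lift x) ⟩
    Ψ (ε ⊛ lift x)            ≡⟨ cong Ψ (⊛-identityˡ (lift x)) ⟩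
    Ψ (lift x)                ≡⟨ Ψ-lift x ⟩
    x                         ∎
    where open ≡-Reasoning

  pow-a : ∀ n → pow a n ≡ Ψ (â^ (+ n))
  pow-a zero    = one≡Ψε
  pow-a (suc n) = trans (cong₂ _·_ a≡Ψâ (pow-a n)) (Ψ-hom â (â^ (+ n)))

  descend : (G → G) → H → H
  descend A = Ψ ∘ A ∘ lift

  descend-id : ∀ {A} → (∀ x → A x ≡ x) → ∀ h → descend A h ≡ h
  descend-id A≡ h = trans (cong Ψ (A≡ (lift h))) (Ψ-lift h)

  module _ {A : G → G} (A-cong : A Preserves _≈_ ⟶ _≈_) where

    descend-Ψ : ∀ x → descend A (Ψ x) ≡ Ψ (A x)
    descend-Ψ x = Ψ-cong (A-cong (lift-Ψ x))

    descend-maps : ∀ x y {h h'} → A x ≡ y → h ≡ Ψ x → h' ≡ Ψ y → descend A h ≡ h'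
    descend-maps x _ Ax≡y refl refl = trans (descend-Ψ x) (cong Ψ Ax≡y)

    descend-∘ : ∀ B h → descend A (descend B h) ≡ descend (A ∘ B) h
    descend-∘ B h = descend-Ψ (B (lift h))

    descend-involutive : (∀ x → A (A x) ≡ x) → ∀ h → descend A (descend A h) ≡ h
    descend-involutive A² h = trans (descend-∘ A h) (descend-id A² h)

    descend-order-3 : (∀ x → A (A (A x)) ≡ x) → ∀ h → descend A (descend A (descend A h)) ≡ h
    descend-order-3 A³ h =
      trans (cong (descend A) (descend-∘ A h)) (trans (descend-∘ (A ∘ A) h) (descend-id A³ h))

-- Automorphisms of Σ_{p,t,s}

module ArcTransitivity (p t s k : ℕ) .{{_ : NonZero p}} (q e : ℕ) (h r : ℤ)
  (p^s≡ : p ^ s ≡ p ℕ.* q) (p^t≡ : p ^ t ≡ p ℕ.* q ℕ.* e)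
  (2h≡1 : + 2 * h ≡ + 1 ⟨mod + p ⟩) (er≡ : + e * r ≡ + k * + k - + k + + 1) where

  open Heis p t s
  open Congruence (+ p) (+ q) (+ e)
  open Quotient p t s q e h p^s≡ p^t≡ 2h≡1

  ba^k≡Ψb̂â^k : b · pow a k ≡ Ψ (b̂â^k (+ k))
  ba^k≡Ψb̂â^k = trans (cong₂ _·_ b≡Ψb̂ (pow-a k)) (Ψ-hom b̂ (â^ (+ k)))

  S : H → Set
  S z = z ∈⟅ one , a , b · pow a k ⟆

  Γ : Graph
  Γ = Sigma p t s k

  EdgeG : G → G → Set
  EdgeG = Edge _⊛_ (Ŝ (+ k))

  EdgeH : H → H → Set
  EdgeH = Edge _·_ S

  Ψ-Ŝ : ∀ {z} → Ŝ (+ k) z → S (Ψ z)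
  Ψ-Ŝ = ∈⟅⟆-map Ψ (inj₁ (sym one≡Ψε)) (inj₂ (inj₁ (sym a≡Ψâ)))
                  (inj₂ (inj₂ (sym ba^k≡Ψb̂â^k)))

  Ψ-edge : ∀ {x y} → EdgeG x y → EdgeH (Ψ x) (Ψ y)
  Ψ-edge {x} (z , z∈Ŝ , refl) = Ψ z , Ψ-Ŝ z∈Ŝ , sym (Ψ-hom z x)

  edge-lift : ∀ {h g} → EdgeH h g → Σ G λ y → EdgeG (lift h) y × g ≡ Ψ y
  edge-lift {h} (z , z∈S , refl)
    with ∈⟅⟆-preimage Ψ (sym one≡Ψε) (sym a≡Ψâ) (sym ba^k≡Ψb̂â^k) z∈S
  ... | ẑ , ẑ∈Ŝ , refl =
    ẑ ⊛ lift h , (ẑ , ẑ∈Ŝ , refl) , trans (cong (Ψ ẑ ·_) (sym (Ψ-lift h))) (Ψ-hom ẑ (lift h))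

  descend-edge : ∀ {A₀ A} → A Preserves _≈_ ⟶ _≈_ →
                 (∀ {x y} → EdgeG x y → EdgeG (A₀ x) (A y)) →
                 ∀ {h g} → EdgeH h g → EdgeH (descend A₀ h) (descend A g)
  descend-edge {A₀} A-cong edge {h} e with edge-lift e
  ... | y , ê , refl =
    subst (EdgeH (descend A₀ h)) (sym (descend-Ψ A-cong y)) (Ψ-edge (edge ê))

  descend-edge-reversed : ∀ {A} → A Preserves _≈_ ⟶ _≈_ →
                          (∀ {x y} → EdgeG x y → EdgeG (A y) (A x)) →
                          ∀ {h g} → EdgeH h g → EdgeH (descend A g) (descend A h)
  descend-edge-reversed {A} A-cong edge {h} e with edge-lift e
  ... | y , ê , refl =
    subst (λ v → EdgeH v (descend A h)) (sym (descend-Ψ A-cong y)) (Ψ-edge (edge ê))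

  α-cong : α (+ k) Preserves _≈_ ⟶ _≈_
  α-cong = preserves-≈ (α-shift (+ k) r er≡)

  rotate-cong : rotate (+ k) Preserves _≈_ ⟶ _≈_
  rotate-cong = ⊛-congˡ â ∘ α-cong

  β-cong : β (+ k) Preserves _≈_ ⟶ _≈_
  β-cong = preserves-≈ (β-shift (+ k))

  open Automorphism using (to)

  translation-by : H → Automorphism Γ
  translation-by w = translation _·_ S ·-assoc w (w ⁻¹ᴴ) (·⁻¹-cancelʳ w) (⁻¹·-cancelʳ w)

  rotation : Automorphism Γ
  rotation = automorphism f (f ∘ f) f³ f³ f-adj (λ e → f-adj (f-adj e))
    where
    f : H ⊎ H → H ⊎ H
    f = map (descend (α (+ k))) (descend (rotate (+ k)))
    f³ : ∀ v → f (f (f v)) ≡ v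
    f³ (inj₁ h) = cong inj₁ (descend-order-3 α-cong (α³ (+ k)) h)
    f³ (inj₂ g) = cong inj₂ (descend-order-3 rotate-cong (rotate³ (+ k)) g)
    f-adj : PreservesAdj {Γ} f
    f-adj = map-preservesAdj _·_ S (descend-edge rotate-cong (rotate-edge (+ k)))

  reflection : Automorphism Γ
  reflection = automorphism f f f² f² f-adj f-adj
    where
    f : H ⊎ H → H ⊎ H
    f = swap ∘ map (descend (β (+ k))) (descend (β (+ k)))
    f² : ∀ v → f (f v) ≡ v
    f² (inj₁ h) = cong inj₁ (descend-involutive β-cong (β-involutive (+ k)) h)
    f² (inj₂ g) = cong inj₂ (descend-involutive β-cong (β-involutive (+ k)) g)
    f-adj : PreservesAdj {Γ} f
    f-adj = swap-map-preservesAdj _·_ S (descend-edge-reversed β-cong (reflect-edge (+ k)))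

  rotation-one₀ : to rotation (inj₁ one) ≡ inj₁ one
  rotation-one₀ = cong inj₁ (descend-maps α-cong ε ε (α-ε (+ k)) one≡Ψε one≡Ψε)

  rotation-one₁ : to rotation (inj₂ one) ≡ inj₂ a
  rotation-one₁ = cong inj₂ (descend-maps rotate-cong ε â (rotate-ε (+ k)) one≡Ψε a≡Ψâ)

  rotation-a₁ : to rotation (inj₂ a) ≡ inj₂ (b · pow a k)
  rotation-a₁ =
    cong inj₂ (descend-maps rotate-cong â (b̂â^k (+ k)) (rotate-â (+ k)) a≡Ψâ ba^k≡Ψb̂â^k)

  reflection-one₀ : to reflection (inj₁ one) ≡ inj₂ one
  reflection-one₀ = cong inj₂ (descend-maps β-cong ε ε (β-ε (+ k)) one≡Ψε one≡Ψε)

  reflection-one₁ : to reflection (inj₂ one) ≡ inj₁ one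
  reflection-one₁ = cong inj₁ (descend-maps β-cong ε ε (β-ε (+ k)) one≡Ψε one≡Ψε)

  BaseArcImage : H ⊎ H → H ⊎ H → Set
  BaseArcImage u v = Σ (Automorphism Γ) λ φ → to φ (inj₁ one) ≡ u × to φ (inj₂ one) ≡ v

  outgoing-arc : ∀ h {z} → S z → BaseArcImage (inj₁ h) (inj₂ (z · h))
  outgoing-arc h (inj₁ refl) = τ , cong inj₁ (one· h) , refl
    where
    τ : Automorphism Γ
    τ = translation-by h
  outgoing-arc h (inj₂ (inj₁ refl)) =
    τ ∘ᴬ rotation ,
    trans (cong (to τ) rotation-one₀) (cong inj₁ (one· h)) ,
    cong (to τ) rotation-one₁
    where
    τ : Automorphism Γ
    τ = translation-by h
  outgoing-arc h (inj₂ (inj₂ refl)) =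
    τ ∘ᴬ rotation ∘ᴬ rotation ,
    trans (cong (to τ ∘ to rotation) rotation-one₀)
          (trans (cong (to τ) rotation-one₀) (cong inj₁ (one· h))) ,
    trans (cong (to τ ∘ to rotation) rotation-one₁) (cong (to τ) rotation-a₁)
    where
    τ : Automorphism Γ
    τ = translation-by h

  base-arc-image : ∀ {u v} → Graph.Adj Γ u v → BaseArcImage u v
  base-arc-image {inj₁ h} {inj₂ _} (z , z∈S , refl) = outgoing-arc h z∈S
  base-arc-image {inj₂ _} {inj₁ h} (z , z∈S , refl) with outgoing-arc h z∈S
  ... | φ , φ₀ , φ₁ =
    φ ∘ᴬ reflection ,
    trans (cong (to φ) reflection-one₀) φ₁ ,
    trans (cong (to φ) reflection-one₁) φ₀

  arcTransitive : ArcTransitive Γ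
  arcTransitive = arcTransitive-from-arc (inj₁ one) (inj₂ one) base-arc-image

odd-prime-%2 : ∀ {p} → Prime p → p ≢ 2 → p % 2 ≡ 1
odd-prime-%2 {p} pp p≢2 with p % 2 in p%2 | m%n<n p 2
... | 1 | _ = refl
... | 0 | _ with prime⇒irreducible pp (m%n≡0⇒n∣m p 2 p%2)
...   | inj₁ ()
...   | inj₂ 2≡p = ⊥-elim (p≢2 (sym 2≡p))
odd-prime-%2 _ _ | suc (suc _) | s≤s (s≤s ())

half-inverse : ∀ p → p % 2 ≡ 1 → + 2 * + suc (p / 2) ≡ + 1 ⟨mod + p ⟩
half-inverse p p%2≡1 = + 1 , (begin
  + 2 * (+ 1 + + (p / 2))                   ≡⟨ double (+ (p / 2)) ⟩
  + 1 + + 1 * (+ 1 + + (p / 2) * + 2)       ≡⟨ cong (λ x → + 1 + + 1 * (+ 1 + x)) (ℤ.pos-* (p / 2) 2) ⟨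
  + 1 + + 1 * + (1 ℕ.+ p / 2 ℕ.* 2)         ≡⟨ cong (λ n → + 1 + + 1 * + n) p≡ ⟨
  + 1 + + 1 * + p                           ∎)
  where
  open ≡-Reasoning
  p≡ : p ≡ 1 ℕ.+ p / 2 ℕ.* 2
  p≡ = trans (m≡m%n+[m/n]*n p 2) (cong (ℕ._+ p / 2 ℕ.* 2) p%2≡1)
  double : ∀ x → + 2 * (+ 1 + x) ≡ + 1 + + 1 * (+ 1 + x * + 2)
  double x = solve (x ∷ [])

n≤n*n+1 : ∀ n → n ≤ n ℕ.* n ℕ.+ 1
n≤n*n+1 zero    = z≤n
n≤n*n+1 (suc n) = ℕ.m≤n⇒m≤n+o 1 (ℕ.m≤m*n (suc n) (suc n))

admissible⇒norm : ∀ {p t s k} → Admissible p t s k →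
                  Σ ℤ λ r → + (p ^ (t ℕ.∸ s)) * r ≡ + k * + k - + k + + 1
admissible⇒norm {p} {t} (inj₁ (refl , refl)) = + 1 , cong (λ n → + (p ^ n) * + 1) (ℕ.n∸n≡0 t)
admissible⇒norm {p} {t} {s} {k} (inj₂ (_ , _ , _ , divides r eq)) = + r , (begin
  + e * + r                    ≡⟨ ℤ.*-comm (+ e) (+ r) ⟩
  + r * + e                    ≡⟨ ℤ.pos-* r e ⟨
  + (r ℕ.* e)                  ≡⟨ cong +_ eq ⟨
  + (k ℕ.* k ℕ.+ 1 ℕ.∸ k)
    ≡⟨ trans (ℤ.m-n≡m⊖n (k ℕ.* k ℕ.+ 1) k) (ℤ.⊖-≥ (n≤n*n+1 k)) ⟨
  + (k ℕ.* k ℕ.+ 1) - + k      ≡⟨ cong (λ x → x + + 1 - + k) (ℤ.pos-* k k) ⟩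
  + k * + k + + 1 - + k        ≡⟨ rearrange (+ k) ⟩
  + k * + k - + k + + 1        ∎)
  where
  open ≡-Reasoning
  e : ℕ
  e = p ^ (t ℕ.∸ s)
  rearrange : ∀ x → x * x + + 1 - x ≡ x * x - x + + 1
  rearrange x = solve (x ∷ [])

lemma4p9 : (p t s k : ℕ) → (pp : Prime p) → p ≢ 2 → 1 ≤ s → s ≤ t →
    Admissible p t s k →
    ArcTransitive (Sigma p t s k {{prime⇒nonZero pp}})
lemma4p9 p t (suc s) k pp p≢2 (s≤s z≤n) s≤t adm with admissible⇒norm adm
... | r , norm = ArcTransitivity.arcTransitive p t (suc s) k {{prime⇒nonZero pp}}
  (p ^ s) (p ^ (t ℕ.∸ suc s)) (+ suc (p / 2)) r
  refl p^t≡ (half-inverse p (odd-prime-%2 pp p≢2)) norm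
  where
  p^t≡ : p ^ t ≡ p ℕ.* p ^ s ℕ.* p ^ (t ℕ.∸ suc s)
  p^t≡ = trans (cong (p ^_) (sym (ℕ.m+[n∸m]≡n s≤t)))
               (ℕ.^-distribˡ-+-* p (suc s) (t ℕ.∸ suc s))
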